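{- For every $n\ge 1$, let $\Sigma_n$ be the loopless Schreier graph of Grigorchuk's group on level $n$, with edge weights given by positive reals $a,b,c,d$ according to the labels. Then the partition function of the dimer model on $\Sigma_n$ is $$\Phi_n(a,b,c,d)=a^{2^{n-1}}.$$
   Context: Grigorchuk's group is generated by the maps $a,b,c,d$ acting on the set $\{0,1\}^n$ of binary words of length $n$ (for every $n$; the empty word is fixed). They are defined recursively, for any binary word $w$, by - $a(0w)=1w$ and $a(1w)=0w$; - $b(0w)=0a(w)$ and $b(1w)=1c(w)$; - $c(0w)=0a(w)$ and $c(1w)=1d(w)$; - $d(0w)=0w$ and $d(1w)=1b(w)$. Each of them is an involution. The loopless Schreier graph $\Sigma_n$ is defined as follows. Its vertex set is $\{0,1\}^n$. For each $s\in\{a,b,c,d\}$ and each unordered pair $\{u,s(u)\}$ with $s(u)\neq u$, there is exactly one edge labeled $s$ joining $u$ and $s(u)$. Hence $\Sigma_n$ may have parallel edges with different labels, and fixed points (loops) are omitted. Weights are assigned as follows: given positive reals, also denoted $a,b,c,d$, an edge labeled $s$ receives weight $s$. A dimer covering is a perfect matching, i.e. a set of edges such that every vertex is an endpoint of exactly one of them. Its weight is the product of the weights of its edges. The partition function $\Phi_n(a,b,c,d)$ is the sum of the weights of all dimer coverings of $\Sigma_n$. -}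

module Defs where

open import Level using (Level)
open import Data.Bool using (Bool; true; false; not; _∧_; _∨_; if_then_else_)
open import Data.Nat using (ℕ; zero; suc; _≡ᵇ_)
open import Data.Vec using (Vec; []; _∷_)
open import Data.List using (List; []; _∷_; _++_; map; concatMap; foldr; length; filter)
open import Data.Product using (_×_; _,_)
open import Algebra.Bundles using (CommutativeSemiring)

-- Binary words of length n: false = 0, true = 1 (first letter = head).
Word : ℕ → Set
Word n = Vec Bool n

data Gen : Set where
  ga gb gc gd : Gen

allGens : List Gen
allGens = ga ∷ gb ∷ gc ∷ gd ∷ []

act : ∀ {n} → Gen → Word n → Word n
act s  []            = []
act ga (x ∷ w)       = not x ∷ w
act gb (false ∷ w)   = false ∷ act ga w
act gb (true  ∷ w)   = true  ∷ act gc w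
act gc (false ∷ w)   = false ∷ act ga w
act gc (true  ∷ w)   = true  ∷ act gd w
act gd (false ∷ w)   = false ∷ w
act gd (true  ∷ w)   = true  ∷ act gb w

allWords : (n : ℕ) → List (Word n)
allWords zero    = [] ∷ []
allWords (suc n) = map (false ∷_) (allWords n) ++ map (true ∷_) (allWords n)

eqW : ∀ {n} → Word n → Word n → Bool
eqW []      []      = true
eqW (x ∷ u) (y ∷ v) = (if x then y else not y) ∧ eqW u v

-- Strict lexicographic order on words (used only to pick one representative
-- of each unordered pair {u, s(u)}).
ltW : ∀ {n} → Word n → Word n → Bool
ltW []          []          = false
ltW (false ∷ u) (false ∷ v) = ltW u v
ltW (true  ∷ u) (true  ∷ v) = ltW u v
ltW (false ∷ u) (true  ∷ v) = true
ltW (true  ∷ u) (false ∷ v) = false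

record Edge (n : ℕ) : Set where
  constructor edge
  field
    label : Gen
    src   : Word n
    tgt   : Word n

-- Edges of the loopless Schreier graph Σ_n: for each label s and each
-- unordered pair {u, s(u)} with s(u) ≠ u exactly one edge labelled s
-- (recorded with the lexicographically smaller endpoint first; since each
-- generator is an involution this lists each such pair exactly once).
edgesAt : ∀ {n} → Word n → List (Edge n)
edgesAt u = concatMap (λ s → if ltW u (act s u) then edge s u (act s u) ∷ [] else []) allGens

edges : (n : ℕ) → List (Edge n)
edges n = concatMap edgesAt (allWords n)

subsets : ∀ {A : Set} → List A → List (List A)
subsets []       = [] ∷ []
subsets (x ∷ xs) = subsets xs ++ map (x ∷_) (subsets xs)

degreeIn : ∀ {n} → List (Edge n) → Word n → ℕ
degreeIn []                  v = 0
degreeIn (edge s x y ∷ M) v =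
  if eqW x v ∨ eqW y v then suc (degreeIn M v) else degreeIn M v

isPerfectMatching : ∀ {n} → List (Edge n) → Bool
isPerfectMatching {n} M = foldr (λ v r → (degreeIn M v ≡ᵇ 1) ∧ r) true (allWords n)

module _ {c ℓ : Level} (R : CommutativeSemiring c ℓ) where
  open CommutativeSemiring R renaming (Carrier to K)

  weight : Gen → K → K → K → K → K
  weight ga wa wb wc wd = wa
  weight gb wa wb wc wd = wb
  weight gc wa wb wc wd = wc
  weight gd wa wb wc wd = wd

  matchingWeight : ∀ {n} → List (Edge n) → K → K → K → K → K
  matchingWeight []                 wa wb wc wd = 1#
  matchingWeight (edge s _ _ ∷ M)   wa wb wc wd =
    weight s wa wb wc wd * matchingWeight M wa wb wc wd

  Φ : (n : ℕ) → K → K → K → K → K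
  Φ n wa wb wc wd =
    foldr (λ M r → (if isPerfectMatching M then matchingWeight M wa wb wc wd else 0#) + r)
          0# (subsets (edges n))

module Submission where

-- The dimer partition function of Σ(m+1) is a ^ 2^m because the only perfect
-- matching of Σ(m+1) is the set of its a-edges, the 2^m pairs {0w, 1w}.
--  * Sums over sublists (any commutative semiring): if P accepts a sublist of
--    xs only when it selects exactly the q-elements, and accepts 'filterᵇ q xs',
--    the P-restricted sum over all sublists is the weight of 'filterᵇ q xs'.
--  * Perfect matchings are the edge sets of degree one at every vertex.
--  * Key lemma: genuine b/c/d-edges of Σn with an a-invariant degree function
--    are absent.  By induction on n: in the subtree 0{0,1}^n the b- and c-edges
--    pair 0x with 0(ax), and the subtree 1{0,1}^n carries a copy of Σn with the
--    labels b, c, d rotated.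
--  * In a perfect matching the a-edges have an a-invariant degree, so by the
--    key lemma only a-edges occur; comparing degrees with all a-edges of Σ(m+1)
--    (themselves a perfect matching) shows that every one of them is selected.

open import Defs
open import Level using (Level)
open import Data.Nat using (ℕ; zero; suc; _+_; _≤_; _∸_; _≡ᵇ_; z≤n; s≤s) renaming (_^_ to _^ℕ_)
open import Algebra.Bundles using (CommutativeSemiring)
open import Algebra.Definitions.RawSemiring using (_^_)
open import Data.Nat.Properties
  using (+-suc; +-cancelˡ-≡; +-identityʳ; ≡ᵇ⇒≡; ≡⇒≡ᵇ; ≤-refl; ≤-trans; n≤1+n; <-irrefl)
open import Data.Bool using (Bool; true; false; not; _∧_; _∨_; if_then_else_; T; T?)
open import Data.Bool.Properties using (∨-comm; ∨-identityʳ; ¬-not; not-¬; T-≡)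
open import Data.Unit using (⊤)
open import Data.Empty using (⊥; ⊥-elim)
open import Data.Product using (_×_; _,_; proj₁; proj₂)
open import Data.Vec using ([]; _∷_)
open import Data.List using (List; []; _∷_; _++_; map; concatMap; foldr; length; filterᵇ)
open import Data.Bool.ListAction using (all)
open import Data.List.Properties using (filter-++; concatMap-++; foldr-map; length-++; length-map; ++-identityʳ)
open import Data.List.Relation.Unary.All using (All; []; _∷_; universal)
import Data.List.Relation.Unary.All as All
open import Data.List.Relation.Unary.All.Properties using (concat⁺; map⁺; all⁺; all⁻)
open import Data.List.Relation.Unary.Any using (here)
open import Data.List.Membership.Propositional using (_∈_)
open import Data.List.Membership.Propositional.Properties using (∈-map⁺; ∈-++⁺ˡ; ∈-++⁺ʳ)
open import Data.List.Relation.Binary.Sublist.Propositional using (_⊆_; []; _∷ʳ_; _∷_)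
open import Data.List.Relation.Binary.Sublist.Propositional.Properties using (All-resp-⊆)
open import Function using (_∘_)
open import Function.Bundles using (Equivalence)
open import Relation.Binary.PropositionalEquality
  using (_≡_; refl; sym; trans; cong; cong₂; subst; module ≡-Reasoning)
import Relation.Binary.Reasoning.Setoid as SetoidReasoning

-- Sums over sublists

SelectsExactly : {X : Set} (q : X → Bool) {M xs : List X} → M ⊆ xs → Set
SelectsExactly q []              = ⊤
SelectsExactly q (x ∷ʳ σ)        = q x ≡ false × SelectsExactly q σ
SelectsExactly q (_∷_ {x = x} _ σ) = q x ≡ true × SelectsExactly q σ

module SublistSums {c ℓ : Level} (R : CommutativeSemiring c ℓ) {X : Set}
    (w : X → CommutativeSemiring.Carrier R) (W : List X → CommutativeSemiring.Carrier R)
    (W-∷ : ∀ x M → CommutativeSemiring._≈_ R (W (x ∷ M)) (CommutativeSemiring._*_ R (w x) (W M)))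
    where
  open CommutativeSemiring R
    using (_≈_; 0#; setoid; +-identityˡ; +-assoc; +-cong; +-congˡ; *-congˡ; zeroʳ; distribˡ)
    renaming (Carrier to K; _+_ to _⊕_; _*_ to _⊗_; +-identityʳ to ⊕-identityʳ;
              sym to ≈-sym; trans to ≈-trans)
  open SetoidReasoning setoid

  restrictedSum : (List X → Bool) → List (List X) → K
  restrictedSum P = foldr (λ M r → (if P M then W M else 0#) ⊕ r) 0#

  restrictedSum-++ : ∀ P Ms Ns →
    restrictedSum P (Ms ++ Ns) ≈ restrictedSum P Ms ⊕ restrictedSum P Ns
  restrictedSum-++ P []       Ns = ≈-sym (+-identityˡ _)
  restrictedSum-++ P (M ∷ Ms) Ns =
    ≈-trans (+-congˡ (restrictedSum-++ P Ms Ns)) (≈-sym (+-assoc _ _ _))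

  restrictedSum-prepend : ∀ P x Ms →
    restrictedSum P (map (x ∷_) Ms) ≈ w x ⊗ restrictedSum (P ∘ (x ∷_)) Ms
  restrictedSum-prepend P x []       = ≈-sym (zeroʳ _)
  restrictedSum-prepend P x (M ∷ Ms) =
    ≈-trans (+-cong (factor (P (x ∷ M))) (restrictedSum-prepend P x Ms)) (≈-sym (distribˡ _ _ _))
    where
    factor : ∀ b → (if b then W (x ∷ M) else 0#) ≈ w x ⊗ (if b then W M else 0#)
    factor true  = W-∷ x M
    factor false = ≈-sym (zeroʳ _)

  -- Sublists of x ∷ xs either omit x or start with x.
  restrictedSum-subsets : ∀ P x xs →
    restrictedSum P (subsets (x ∷ xs))
      ≈ restrictedSum P (subsets xs) ⊕ w x ⊗ restrictedSum (P ∘ (x ∷_)) (subsets xs)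
  restrictedSum-subsets P x xs =
    ≈-trans (restrictedSum-++ P (subsets xs) _) (+-congˡ (restrictedSum-prepend P x (subsets xs)))

  sum-vanishes : ∀ P xs → (∀ M → M ⊆ xs → P M ≡ false) → restrictedSum P (subsets xs) ≈ 0#
  sum-vanishes P [] none with P [] | none [] []
  ... | false | refl = +-identityˡ 0#
  sum-vanishes P (x ∷ xs) none = begin
    restrictedSum P (subsets (x ∷ xs))
      ≈⟨ restrictedSum-subsets P x xs ⟩
    restrictedSum P (subsets xs) ⊕ w x ⊗ restrictedSum (P ∘ (x ∷_)) (subsets xs)
      ≈⟨ +-cong (sum-vanishes P xs (λ M σ → none M (x ∷ʳ σ)))
                (*-congˡ (sum-vanishes (P ∘ (x ∷_)) xs (λ M σ → none (x ∷ M) (refl ∷ σ)))) ⟩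
    0# ⊕ w x ⊗ 0#
      ≈⟨ ≈-trans (+-identityˡ _) (zeroʳ _) ⟩
    0# ∎

  sum-single : ∀ (q : X → Bool) P xs →
    (∀ M (σ : M ⊆ xs) → P M ≡ true → SelectsExactly q σ) →
    P (filterᵇ q xs) ≡ true → restrictedSum P (subsets xs) ≈ W (filterᵇ q xs)
  sum-single q P [] exact accepted rewrite accepted = ⊕-identityʳ _
  sum-single q P (x ∷ xs) exact accepted with q x in qx
  ... | true = begin
    restrictedSum P (subsets (x ∷ xs))
      ≈⟨ restrictedSum-subsets P x xs ⟩
    restrictedSum P (subsets xs) ⊕ w x ⊗ restrictedSum (P ∘ (x ∷_)) (subsets xs)
      ≈⟨ +-cong (sum-vanishes P xs (λ M σ → ¬-not (λ pM → not-¬ qx (proj₁ (exact M (x ∷ʳ σ) pM)))))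
                (*-congˡ (sum-single q (P ∘ (x ∷_)) xs
                            (λ M σ pM → proj₂ (exact (x ∷ M) (refl ∷ σ) pM)) accepted)) ⟩
    0# ⊕ w x ⊗ W (filterᵇ q xs)
      ≈⟨ ≈-trans (+-identityˡ _) (≈-sym (W-∷ x _)) ⟩
    W (x ∷ filterᵇ q xs) ∎
  ... | false = begin
    restrictedSum P (subsets (x ∷ xs))
      ≈⟨ restrictedSum-subsets P x xs ⟩
    restrictedSum P (subsets xs) ⊕ w x ⊗ restrictedSum (P ∘ (x ∷_)) (subsets xs)
      ≈⟨ +-cong (sum-single q P xs (λ M σ pM → proj₂ (exact M (x ∷ʳ σ) pM)) accepted)
                (*-congˡ (sum-vanishes (P ∘ (x ∷_)) xs
                            (λ M σ → ¬-not (λ pM → not-¬ qx (proj₁ (exact (x ∷ M) (refl ∷ σ) pM)))))) ⟩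
    W (filterᵇ q xs) ⊕ w x ⊗ 0#
      ≈⟨ ≈-trans (+-congˡ (zeroʳ _)) (⊕-identityʳ _) ⟩
    W (filterᵇ q xs) ∎

eqW-refl : ∀ {n} (u : Word n) → eqW u u ≡ true
eqW-refl []          = refl
eqW-refl (true ∷ u)  = eqW-refl u
eqW-refl (false ∷ u) = eqW-refl u

ltW-irrefl : ∀ {n} (u : Word n) → ltW u u ≡ false
ltW-irrefl []          = refl
ltW-irrefl (true ∷ u)  = ltW-irrefl u
ltW-irrefl (false ∷ u) = ltW-irrefl u

-- a acts by flipping the first letter, so it commutes with the equality test.
eqW-act-a : ∀ {n} (x w : Word n) → eqW (act ga x) (act ga w) ≡ eqW x w
eqW-act-a []          []          = refl
eqW-act-a (true ∷ x)  (true ∷ w)  = refl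
eqW-act-a (true ∷ x)  (false ∷ w) = refl
eqW-act-a (false ∷ x) (true ∷ w)  = refl
eqW-act-a (false ∷ x) (false ∷ w) = refl

eqW-act-a-swap : ∀ {n} (x w : Word n) → eqW x (act ga w) ≡ eqW (act ga x) w
eqW-act-a-swap []          []          = refl
eqW-act-a-swap (true ∷ x)  (true ∷ w)  = refl
eqW-act-a-swap (true ∷ x)  (false ∷ w) = refl
eqW-act-a-swap (false ∷ x) (true ∷ w)  = refl
eqW-act-a-swap (false ∷ x) (false ∷ w) = refl

pair-a-invariant : ∀ {n} (x w : Word n) →
  (eqW x w ∨ eqW (act ga x) w) ≡ (eqW x (act ga w) ∨ eqW (act ga x) (act ga w))
pair-a-invariant x w =
  trans (∨-comm (eqW x w) _) (sym (cong₂ _∨_ (eqW-act-a-swap x w) (eqW-act-a x w)))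

-- 'degreeIn (e ∷ M) v' is by definition 'bump (incident e v) (degreeIn M v)'.
incident : ∀ {n} → Edge n → Word n → Bool
incident e v = eqW (Edge.src e) v ∨ eqW (Edge.tgt e) v

bump : Bool → ℕ → ℕ
bump b d = if b then suc d else d

bump-+ˡ : ∀ b m n → bump b (m + n) ≡ bump b m + n
bump-+ˡ true  m n = refl
bump-+ˡ false m n = refl

bump-+ʳ : ∀ b m n → bump b (m + n) ≡ m + bump b n
bump-+ʳ true  m n = sym (+-suc m n)
bump-+ʳ false m n = refl

bump-injective : ∀ b {m n} → bump b m ≡ bump b n → m ≡ n
bump-injective true  refl = refl
bump-injective false refl = refl

bump-mono : ∀ b {m n} → m ≤ n → bump b m ≤ bump b n
bump-mono true  m≤n = s≤s m≤n
bump-mono false m≤n = m≤n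

bump-≥ : ∀ b n → n ≤ bump b n
bump-≥ true  n = n≤1+n n
bump-≥ false n = ≤-refl

incident-src : ∀ {n} (e : Edge n) → incident e (Edge.src e) ≡ true
incident-src e = cong (_∨ eqW (Edge.tgt e) (Edge.src e)) (eqW-refl (Edge.src e))

degree-split : ∀ {n} (q : Edge n → Bool) (L : List (Edge n)) v →
  degreeIn L v ≡ degreeIn (filterᵇ q L) v + degreeIn (filterᵇ (not ∘ q) L) v
degree-split q []      v = refl
degree-split q (e ∷ L) v with q e
... | true  = trans (cong (bump (incident e v)) (degree-split q L v)) (bump-+ˡ (incident e v) _ _)
... | false = trans (cong (bump (incident e v)) (degree-split q L v)) (bump-+ʳ (incident e v) _ _)

isolated⇒empty : ∀ {n} (N : List (Edge n)) → (∀ v → degreeIn N v ≡ 0) → N ≡ []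
isolated⇒empty []      _        = refl
isolated⇒empty (e ∷ N) isolated with incident e (Edge.src e) | incident-src e | isolated (Edge.src e)
... | true | refl | ()

allWords-complete : ∀ n (v : Word n) → v ∈ allWords n
allWords-complete zero    []          = here refl
allWords-complete (suc n) (false ∷ v) = ∈-++⁺ˡ (∈-map⁺ (false ∷_) (allWords-complete n v))
allWords-complete (suc n) (true ∷ v)  =
  ∈-++⁺ʳ (map (false ∷_) (allWords n)) (∈-map⁺ (true ∷_) (allWords-complete n v))

degree-one? : ∀ {n} → List (Edge n) → Word n → Bool
degree-one? M v = degreeIn M v ≡ᵇ 1

isPerfectMatching-all : ∀ {n} (M : List (Edge n)) →
  isPerfectMatching M ≡ all (degree-one? M) (allWords n)
isPerfectMatching-all {n} M = sym (foldr-map _∧_ (degree-one? M) true (allWords n))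

perfect⇒degree-one : ∀ {n} (M : List (Edge n)) → isPerfectMatching M ≡ true →
  ∀ v → degreeIn M v ≡ 1
perfect⇒degree-one {n} M pm v =
  ≡ᵇ⇒≡ _ 1 (All.lookup (all⁺ (degree-one? M) (allWords n) everywhere) (allWords-complete n v))
  where
  everywhere : T (all (degree-one? M) (allWords n))
  everywhere = Equivalence.from T-≡ (trans (sym (isPerfectMatching-all M)) pm)

degree-one⇒perfect : ∀ {n} (M : List (Edge n)) → (∀ v → degreeIn M v ≡ 1) →
  isPerfectMatching M ≡ true
degree-one⇒perfect {n} M one =
  trans (isPerfectMatching-all M)
    (Equivalence.to T-≡ (all⁻ (degree-one? M) (universal (λ v → ≡⇒≡ᵇ _ 1 (one v)) (allWords n))))

-- The edges listed in 'edges n': an s-edge from u to su that is not a loop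
-- (and is recorded from its lexicographically smaller end).
data Genuine {n} : Edge n → Set where
  genuine : ∀ s u → ltW u (act s u) ≡ true → Genuine (edge s u (act s u))

edges-genuine : ∀ n → All Genuine (edges n)
edges-genuine n = concat⁺ (map⁺ (universal edgesAt-genuine (allWords n)))
  where
  candidate-genuine : ∀ (u : Word n) s →
    All Genuine (if ltW u (act s u) then edge s u (act s u) ∷ [] else [])
  candidate-genuine u s with ltW u (act s u) in lt
  ... | true  = genuine s u lt ∷ []
  ... | false = []
  edgesAt-genuine : (u : Word n) → All Genuine (edgesAt u)
  edgesAt-genuine u = concat⁺ (map⁺ (universal (candidate-genuine u) allGens))

isA : Gen → Bool
isA ga = true
isA _  = false

isAEdge : ∀ {n} → Edge n → Bool
isAEdge e = isA (Edge.label e)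

data NonAEdge {n} : Edge n → Set where
  b-edge : ∀ u → ltW u (act gb u) ≡ true → NonAEdge (edge gb u (act gb u))
  c-edge : ∀ u → ltW u (act gc u) ≡ true → NonAEdge (edge gc u (act gc u))
  d-edge : ∀ u → ltW u (act gd u) ≡ true → NonAEdge (edge gd u (act gd u))

nonA-edges : ∀ {n} {L : List (Edge n)} → All Genuine L → All NonAEdge (filterᵇ (not ∘ isAEdge) L)
nonA-edges []                    = []
nonA-edges (genuine ga u lt ∷ gs) = nonA-edges gs
nonA-edges (genuine gb u lt ∷ gs) = b-edge u lt ∷ nonA-edges gs
nonA-edges (genuine gc u lt ∷ gs) = c-edge u lt ∷ nonA-edges gs
nonA-edges (genuine gd u lt ∷ gs) = d-edge u lt ∷ nonA-edges gs

-- Each a-edge is a pair {u, au}, so the degree of the a-edges is a-invariant.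
a-degree-invariant : ∀ {n} {L : List (Edge n)} → All Genuine L → ∀ v →
  degreeIn (filterᵇ isAEdge L) v ≡ degreeIn (filterᵇ isAEdge L) (act ga v)
a-degree-invariant []                    v = refl
a-degree-invariant (genuine ga u lt ∷ gs) v = cong₂ bump (pair-a-invariant u v) (a-degree-invariant gs v)
a-degree-invariant (genuine gb u lt ∷ gs) v = a-degree-invariant gs v
a-degree-invariant (genuine gc u lt ∷ gs) v = a-degree-invariant gs v
a-degree-invariant (genuine gd u lt ∷ gs) v = a-degree-invariant gs v

-- The key lemma: b/c/d-edges with an a-invariant degree function are absent

-- Restriction to the subtree 1{0,1}^n: since b(1w) = 1c(w), c(1w) = 1d(w) and
-- d(1w) = 1b(w), the b/c/d-edges there form a set of b/c/d-edges of Σn with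
-- the labels rotated.
rotate : Gen → Gen
rotate ga = ga
rotate gb = gc
rotate gc = gd
rotate gd = gb

restrictToOne : ∀ {n} → List (Edge (suc n)) → List (Edge n)
restrictToOne []                                = []
restrictToOne (edge s (true ∷ x) (_ ∷ y) ∷ N)   = edge (rotate s) x y ∷ restrictToOne N
restrictToOne (edge s (false ∷ x) _ ∷ N)        = restrictToOne N

restrictToOne-nonA : ∀ {n} {N : List (Edge (suc n))} → All NonAEdge N → All NonAEdge (restrictToOne N)
restrictToOne-nonA []                           = []
restrictToOne-nonA (b-edge (true ∷ x) lt ∷ ns)  = c-edge x lt ∷ restrictToOne-nonA ns
restrictToOne-nonA (b-edge (false ∷ x) lt ∷ ns) = restrictToOne-nonA ns
restrictToOne-nonA (c-edge (true ∷ x) lt ∷ ns)  = d-edge x lt ∷ restrictToOne-nonA ns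
restrictToOne-nonA (c-edge (false ∷ x) lt ∷ ns) = restrictToOne-nonA ns
restrictToOne-nonA (d-edge (true ∷ x) lt ∷ ns)  = b-edge x lt ∷ restrictToOne-nonA ns
restrictToOne-nonA (d-edge (false ∷ x) lt ∷ ns) = restrictToOne-nonA ns

degree-restrictToOne : ∀ {n} {N : List (Edge (suc n))} → All NonAEdge N → ∀ w →
  degreeIn N (true ∷ w) ≡ degreeIn (restrictToOne N) w
degree-restrictToOne []                           w = refl
degree-restrictToOne (b-edge (true ∷ x) lt ∷ ns)  w = cong (bump _) (degree-restrictToOne ns w)
degree-restrictToOne (b-edge (false ∷ x) lt ∷ ns) w = degree-restrictToOne ns w
degree-restrictToOne (c-edge (true ∷ x) lt ∷ ns)  w = cong (bump _) (degree-restrictToOne ns w)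
degree-restrictToOne (c-edge (false ∷ x) lt ∷ ns) w = degree-restrictToOne ns w
degree-restrictToOne (d-edge (true ∷ x) lt ∷ ns)  w = cong (bump _) (degree-restrictToOne ns w)
degree-restrictToOne (d-edge (false ∷ x) lt ∷ ns) w = degree-restrictToOne ns w

-- In the subtree 0{0,1}^n, b and c act as a on the tail and d fixes every
-- word (so it contributes no genuine edge); hence the degree there is
-- invariant under 0w ↦ 0(aw).
degree-zero-subtree : ∀ {n} {N : List (Edge (suc n))} → All NonAEdge N → ∀ w →
  degreeIn N (false ∷ w) ≡ degreeIn N (false ∷ act ga w)
degree-zero-subtree []                           w = refl
degree-zero-subtree (b-edge (false ∷ x) lt ∷ ns) w = cong₂ bump (pair-a-invariant x w) (degree-zero-subtree ns w)
degree-zero-subtree (c-edge (false ∷ x) lt ∷ ns) w = cong₂ bump (pair-a-invariant x w) (degree-zero-subtree ns w)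
degree-zero-subtree (d-edge (false ∷ x) lt ∷ ns) w with trans (sym lt) (ltW-irrefl x)
... | ()
degree-zero-subtree (b-edge (true ∷ x) lt ∷ ns)  w = degree-zero-subtree ns w
degree-zero-subtree (c-edge (true ∷ x) lt ∷ ns)  w = degree-zero-subtree ns w
degree-zero-subtree (d-edge (true ∷ x) lt ∷ ns)  w = degree-zero-subtree ns w

-- The key lemma.  At level 0 there are no genuine edges; at level n+1 the
-- restriction to 1{0,1}^n is again a-invariant, so it is isolated by
-- induction, and then so is N on both subtrees.
a-invariant-nonA⇒isolated : ∀ n (N : List (Edge n)) → All NonAEdge N →
  (∀ v → degreeIn N v ≡ degreeIn N (act ga v)) → ∀ v → degreeIn N v ≡ 0
a-invariant-nonA⇒isolated zero    []      []                _ v = refl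
a-invariant-nonA⇒isolated zero    (_ ∷ _) (b-edge [] () ∷ _) _ v
a-invariant-nonA⇒isolated zero    (_ ∷ _) (c-edge [] () ∷ _) _ v
a-invariant-nonA⇒isolated zero    (_ ∷ _) (d-edge [] () ∷ _) _ v
a-invariant-nonA⇒isolated (suc n) N       ns                invariant = isolated
  where
  open ≡-Reasoning
  N₁ : List (Edge n)
  N₁ = restrictToOne N
  -- Going 1w → 0w → 0(aw) → 1(aw) shows that N₁ is again a-invariant.
  invariant₁ : ∀ w → degreeIn N₁ w ≡ degreeIn N₁ (act ga w)
  invariant₁ w = begin
    degreeIn N₁ w                 ≡⟨ sym (degree-restrictToOne ns w) ⟩
    degreeIn N (true ∷ w)         ≡⟨ invariant (true ∷ w) ⟩
    degreeIn N (false ∷ w)        ≡⟨ degree-zero-subtree ns w ⟩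
    degreeIn N (false ∷ act ga w) ≡⟨ invariant (false ∷ act ga w) ⟩
    degreeIn N (true ∷ act ga w)  ≡⟨ degree-restrictToOne ns (act ga w) ⟩
    degreeIn N₁ (act ga w)        ∎
  isolated₁ : ∀ w → degreeIn N₁ w ≡ 0
  isolated₁ = a-invariant-nonA⇒isolated n N₁ (restrictToOne-nonA ns) invariant₁
  isolated : ∀ v → degreeIn N v ≡ 0
  isolated (true ∷ w)  = trans (degree-restrictToOne ns w) (isolated₁ w)
  isolated (false ∷ w) = trans (invariant (false ∷ w)) (trans (degree-restrictToOne ns w) (isolated₁ w))

-- Perfect matchings select exactly the a-edges

onlyAccepted : ∀ {X : Set} (q : X → Bool) (L : List X) → filterᵇ (not ∘ q) L ≡ [] →
  All (λ x → q x ≡ true) L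
onlyAccepted q []      _ = []
onlyAccepted q (x ∷ L) none with q x in qx
... | true = qx ∷ onlyAccepted q L none

-- In a perfect matching the a-edges give an a-invariant degree function, so
-- the b/c/d-edges do as well and hence are absent.
perfect⇒onlyA : ∀ {n} {M : List (Edge n)} → All Genuine M → isPerfectMatching M ≡ true →
  All (λ e → isAEdge e ≡ true) M
perfect⇒onlyA {n} {M} gs pm =
  onlyAccepted isAEdge M (isolated⇒empty Mbcd
    (a-invariant-nonA⇒isolated n Mbcd (nonA-edges gs) invariant))
  where
  open ≡-Reasoning
  Ma Mbcd : List (Edge n)
  Ma   = filterᵇ isAEdge M
  Mbcd = filterᵇ (not ∘ isAEdge) M
  invariant : ∀ v → degreeIn Mbcd v ≡ degreeIn Mbcd (act ga v)
  invariant v = +-cancelˡ-≡ (degreeIn Ma v) _ _ (begin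
    degreeIn Ma v + degreeIn Mbcd v               ≡⟨ sym (degree-split isAEdge M v) ⟩
    degreeIn M v                                  ≡⟨ perfect⇒degree-one M pm v ⟩
    1                                             ≡⟨ sym (perfect⇒degree-one M pm (act ga v)) ⟩
    degreeIn M (act ga v)                         ≡⟨ degree-split isAEdge M (act ga v) ⟩
    degreeIn Ma (act ga v) + degreeIn Mbcd (act ga v)
      ≡⟨ cong (_+ degreeIn Mbcd (act ga v)) (sym (a-degree-invariant gs v)) ⟩
    degreeIn Ma v + degreeIn Mbcd (act ga v)      ∎)

degree-mono : ∀ {n} (q : Edge n → Bool) {M xs : List (Edge n)} → M ⊆ xs →
  All (λ e → q e ≡ true) M → ∀ v → degreeIn M v ≤ degreeIn (filterᵇ q xs) v
degree-mono q []               _        v = z≤n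
degree-mono q (e ∷ʳ σ)         qs       v with q e
... | true  = ≤-trans (degree-mono q σ qs v) (bump-≥ (incident e v) _)
... | false = degree-mono q σ qs v
degree-mono q (_∷_ {x = e} refl σ) (qe ∷ qs) v with q e | qe
... | true | refl = bump-mono (incident e v) (degree-mono q σ qs v)

-- A sublist of q-elements with the same degrees as all the q-elements of xs
-- keeps every one of them: a skipped q-edge would be missing at its source.
same-degrees⇒selectsExactly : ∀ {n} (q : Edge n → Bool) {M xs : List (Edge n)} (σ : M ⊆ xs) →
  All (λ e → q e ≡ true) M → (∀ v → degreeIn M v ≡ degreeIn (filterᵇ q xs) v) →
  SelectsExactly q σ
same-degrees⇒selectsExactly q [] _ _ = _
same-degrees⇒selectsExactly q {M} {_ ∷ xs} (e ∷ʳ σ) qs same with q e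
... | false = refl , same-degrees⇒selectsExactly q σ qs same
... | true  = ⊥-elim (<-irrefl refl (subst (_≤ _) missing-at-src (degree-mono q σ qs (Edge.src e))))
  where
  missing-at-src : degreeIn M (Edge.src e) ≡ suc (degreeIn (filterᵇ q xs) (Edge.src e))
  missing-at-src =
    trans (same (Edge.src e)) (cong (λ b → bump b (degreeIn (filterᵇ q xs) (Edge.src e))) (incident-src e))
same-degrees⇒selectsExactly q (_∷_ {x = e} refl σ) (qe ∷ qs) same with q e | qe
... | true | refl =
  refl , same-degrees⇒selectsExactly q σ qs (λ v → bump-injective (incident e v) (same v))

-- The a-edges of Σ(m+1)

aEdge : ∀ {m} → Word m → Edge (suc m)
aEdge w = edge ga (false ∷ w) (true ∷ w)

-- The a-edge {0w, 1w} is listed at 0w, the smaller of its two ends.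
a-edges-at-zero : ∀ {m} (w : Word m) → filterᵇ isAEdge (edgesAt (false ∷ w)) ≡ aEdge w ∷ []
a-edges-at-zero w with ltW w (act ga w) | ltW w w
... | true  | true  = refl
... | true  | false = refl
... | false | true  = refl
... | false | false = refl

-- At 1w nothing is an a-edge: the a-candidate fails ltW (1w) (0w), whatever
-- the b/c/d-candidates are.
a-edges-at-one : ∀ {m} (w : Word m) → filterᵇ isAEdge (edgesAt (true ∷ w)) ≡ []
a-edges-at-one w with ltW w (act gc w) | ltW w (act gd w) | ltW w (act gb w)
... | true  | true  | true  = refl
... | true  | true  | false = refl
... | true  | false | true  = refl
... | true  | false | false = refl
... | false | true  | true  = refl
... | false | true  | false = refl
... | false | false | true  = refl
... | false | false | false = refl

a-edges : ∀ m → filterᵇ isAEdge (edges (suc m)) ≡ map aEdge (allWords m)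
a-edges m = begin
  filterᵇ isAEdge (edges (suc m))
    ≡⟨ cong (filterᵇ isAEdge) (concatMap-++ edgesAt (map (false ∷_) ws) (map (true ∷_) ws)) ⟩
  filterᵇ isAEdge (concatMap edgesAt (map (false ∷_) ws) ++ concatMap edgesAt (map (true ∷_) ws))
    ≡⟨ filter-++ (T? ∘ isAEdge) (concatMap edgesAt (map (false ∷_) ws)) _ ⟩
  filterᵇ isAEdge (concatMap edgesAt (map (false ∷_) ws))
    ++ filterᵇ isAEdge (concatMap edgesAt (map (true ∷_) ws))
    ≡⟨ cong₂ _++_ (zero-half ws) (one-half ws) ⟩
  map aEdge ws ++ []
    ≡⟨ ++-identityʳ (map aEdge ws) ⟩
  map aEdge ws ∎
  where
  open ≡-Reasoning
  ws : List (Word m)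
  ws = allWords m
  zero-half : ∀ vs → filterᵇ isAEdge (concatMap edgesAt (map (false ∷_) vs)) ≡ map aEdge vs
  zero-half []       = refl
  zero-half (v ∷ vs) = trans (filter-++ (T? ∘ isAEdge) (edgesAt (false ∷ v)) _)
                             (cong₂ _++_ (a-edges-at-zero v) (zero-half vs))
  one-half : ∀ vs → filterᵇ isAEdge (concatMap edgesAt (map (true ∷_) vs)) ≡ []
  one-half []       = refl
  one-half (v ∷ vs) = trans (filter-++ (T? ∘ isAEdge) (edgesAt (true ∷ v)) _)
                            (cong₂ _++_ (a-edges-at-one v) (one-half vs))

multiplicity : ∀ {m} → Word m → List (Word m) → ℕ
multiplicity x []       = 0
multiplicity x (w ∷ ws) = bump (eqW w x) (multiplicity x ws)

multiplicity-++ : ∀ {m} (x : Word m) ws vs →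
  multiplicity x (ws ++ vs) ≡ multiplicity x ws + multiplicity x vs
multiplicity-++ x []       vs = refl
multiplicity-++ x (w ∷ ws) vs =
  trans (cong (bump (eqW w x)) (multiplicity-++ x ws vs)) (bump-+ˡ (eqW w x) _ _)

multiplicity-same-head : ∀ {m} b (x : Word m) ws → multiplicity (b ∷ x) (map (b ∷_) ws) ≡ multiplicity x ws
multiplicity-same-head b     x []       = refl
multiplicity-same-head true  x (w ∷ ws) = cong (bump (eqW w x)) (multiplicity-same-head true x ws)
multiplicity-same-head false x (w ∷ ws) = cong (bump (eqW w x)) (multiplicity-same-head false x ws)

multiplicity-other-head : ∀ {m} b (x : Word m) ws → multiplicity (b ∷ x) (map (not b ∷_) ws) ≡ 0
multiplicity-other-head b     x []       = refl
multiplicity-other-head true  x (w ∷ ws) = multiplicity-other-head true x ws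
multiplicity-other-head false x (w ∷ ws) = multiplicity-other-head false x ws

multiplicity-allWords : ∀ m (x : Word m) → multiplicity x (allWords m) ≡ 1
multiplicity-allWords zero    []          = refl
multiplicity-allWords (suc m) (false ∷ x) =
  trans (multiplicity-++ (false ∷ x) (map (false ∷_) (allWords m)) _)
    (cong₂ _+_ (trans (multiplicity-same-head false x (allWords m)) (multiplicity-allWords m x))
               (multiplicity-other-head false x (allWords m)))
multiplicity-allWords (suc m) (true ∷ x)  =
  trans (multiplicity-++ (true ∷ x) (map (false ∷_) (allWords m)) _)
    (cong₂ _+_ (multiplicity-other-head true x (allWords m))
               (trans (multiplicity-same-head true x (allWords m)) (multiplicity-allWords m x)))

degree-aEdges : ∀ {m} (ws : List (Word m)) b x → degreeIn (map aEdge ws) (b ∷ x) ≡ multiplicity x ws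
degree-aEdges []       b     x = refl
degree-aEdges (w ∷ ws) false x = cong₂ bump (∨-identityʳ (eqW w x)) (degree-aEdges ws false x)
degree-aEdges (w ∷ ws) true  x = cong (bump (eqW w x)) (degree-aEdges ws true x)

a-edges-degree-one : ∀ m (v : Word (suc m)) → degreeIn (filterᵇ isAEdge (edges (suc m))) v ≡ 1
a-edges-degree-one m (b ∷ x) =
  trans (cong (λ A → degreeIn A (b ∷ x)) (a-edges m))
        (trans (degree-aEdges (allWords m) b x) (multiplicity-allWords m x))

length-allWords : ∀ m → length (allWords m) ≡ 2 ^ℕ m
length-allWords zero    = refl
length-allWords (suc m) =
  trans (length-++ (map (false ∷_) (allWords m)))
    (trans (cong₂ _+_ (trans (length-map (false ∷_) (allWords m)) (length-allWords m))
                      (trans (length-map (true ∷_) (allWords m)) (length-allWords m)))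
           (cong (2 ^ℕ m +_) (sym (+-identityʳ (2 ^ℕ m)))))

weight-aEdges : ∀ {c ℓ} (R : CommutativeSemiring c ℓ) {m} (ws : List (Word m))
  (wa wb wc wd : CommutativeSemiring.Carrier R) →
  matchingWeight R (map aEdge ws) wa wb wc wd ≡ _^_ (CommutativeSemiring.rawSemiring R) wa (length ws)
weight-aEdges R []       wa wb wc wd = refl
weight-aEdges R (w ∷ ws) wa wb wc wd = cong (CommutativeSemiring._*_ R wa) (weight-aEdges R ws wa wb wc wd)

-- The partition function

a-edges-perfect : ∀ m → isPerfectMatching (filterᵇ isAEdge (edges (suc m))) ≡ true
a-edges-perfect m = degree-one⇒perfect (filterᵇ isAEdge (edges (suc m))) (a-edges-degree-one m)

perfect⇒selects-a-edges : ∀ m M (σ : M ⊆ edges (suc m)) → isPerfectMatching M ≡ true →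
  SelectsExactly isAEdge σ
perfect⇒selects-a-edges m M σ pm =
  same-degrees⇒selectsExactly isAEdge σ
    (perfect⇒onlyA (All-resp-⊆ σ (edges-genuine (suc m))) pm)
    (λ v → trans (perfect⇒degree-one M pm v) (sym (a-edges-degree-one m v)))

theorem2p2 : {c ℓ : Level} (R : CommutativeSemiring c ℓ) →
    (n : ℕ) → 1 ≤ n →
    (a b c' d : CommutativeSemiring.Carrier R) →
    CommutativeSemiring._≈_ R (Φ R n a b c' d)
      (_^_ (CommutativeSemiring.rawSemiring R) a (2 ^ℕ (n ∸ 1)))
theorem2p2 R (suc m) _ a b c' d = begin
  Φ R (suc m) a b c' d
    ≈⟨ sum-single isAEdge isPerfectMatching (edges (suc m))
                  (perfect⇒selects-a-edges m) (a-edges-perfect m) ⟩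
  W (filterᵇ isAEdge (edges (suc m)))  ≡⟨ cong W (a-edges m) ⟩
  W (map aEdge (allWords m))           ≡⟨ weight-aEdges R (allWords m) a b c' d ⟩
  power a (length (allWords m))        ≡⟨ cong (power a) (length-allWords m) ⟩
  power a (2 ^ℕ m)                     ∎
  where
  open CommutativeSemiring R using (setoid; rawSemiring) renaming (refl to ≈-refl)
  open SetoidReasoning setoid
  W : List (Edge (suc m)) → CommutativeSemiring.Carrier R
  W M = matchingWeight R M a b c' d
  open SublistSums R (λ e → weight R (Edge.label e) a b c' d) W (λ _ _ → ≈-refl)
  power : CommutativeSemiring.Carrier R → ℕ → CommutativeSemiring.Carrier R
  power = _^_ rawSemiring
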